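{- Let $\pi$ be a permutation of $[n]$, let $\tau$ be an assignment of types in $\{\mathrm{Q},\mathrm{S}\}$ to piles, and let $\rho:[n]\to\mathbb{N}$ be a pile assignment function (with $\tau$ defined on all values of $\rho$). Then the heterogeneous shuffle $(\tau,\rho)$ sorts $\pi$ if and only if $$\rho(s+1)\ \ge\ \rho(s)+\big[\pi(s+1)\prec_{\tau(\rho(s))}\pi(s)\big]\qquad\text{for all } s\in[n-1],$$ where $i\prec_{\mathrm{Q}} j\iff i<j$ and $i\prec_{\mathrm{S}} j\iff i>j$.
   Context: A deck of cards labelled by $[n]$ is represented by a permutation $\pi$ of $[n]$ with $\pi(s)$ the position (from the top) of label $s$. In a pile shuffle, label $s$ is dealt to the $\rho(s)$-th pile collected. Each pile $p$ has a type $\tau(p)\in\{\mathrm{Q},\mathrm{S}\}$: a queue (Q) preserves the order of cards placed on it, a stack (S) reverses it. Let $\chi(p)=[\tau(p)=\mathrm{S}]$. The heterogeneous shuffle of $\pi$ with type assignment $\tau$ and pile assignments $\rho$ is the unique permutation $\sigma$ of $[n]$ with $\sigma(s)<\sigma(t)$ iff $\big(\rho(s),(-1)^{\chi(\rho(s))}\pi(s)\big)<\big(\rho(t),(-1)^{\chi(\rho(t))}\pi(t)\big)$ lexicographically. $(\tau,\rho)$ sorts $\pi$ if $\sigma$ is the identity. $[P]$ is the indicator of $P$. -}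

module Defs where

open import Data.Nat as ℕ using (ℕ; suc; _+_; _≥_)
open import Data.Nat.Properties using (<-trans; n<1+n)
open import Data.Integer as ℤ using (ℤ; +_; -_)
open import Data.Fin as Fin using (Fin; toℕ; fromℕ<)
open import Data.Fin.Permutation using (Permutation′; _⟨$⟩ʳ_; id)
open import Data.Product using (_×_; _,_)
open import Data.Product.Relation.Binary.Lex.Strict using (×-Lex)
open import Relation.Binary.PropositionalEquality using (_≡_)
open import Relation.Nullary using (Dec; yes; no)
open import Function.Bundles using (_⇔_)

-- Pile types: queue (Q) preserves order, stack (S) reverses it.
data PileType : Set where
  Q S : PileType

-- Labels [n] and positions [n] are represented by Fin n (0-based: label s ↦ s-1).
-- The key of label s: (ρ(s), (-1)^χ(ρ(s)) · π(s)).
key : {n : ℕ} → Permutation′ n → (ℕ → PileType) → (Fin n → ℕ) → Fin n → ℕ × ℤ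
key π τ ρ s with τ (ρ s)
... | Q = ρ s , + toℕ (π ⟨$⟩ʳ s)
... | S = ρ s , - (+ toℕ (π ⟨$⟩ʳ s))

_<lex_ : ℕ × ℤ → ℕ × ℤ → Set
_<lex_ = ×-Lex _≡_ ℕ._<_ ℤ._<_

IsHetShuffle : {n : ℕ} → (ℕ → PileType) → (Fin n → ℕ) → Permutation′ n → Permutation′ n → Set
IsHetShuffle τ ρ π σ =
  ∀ s t → ((σ ⟨$⟩ʳ s) Fin.< (σ ⟨$⟩ʳ t)) ⇔ (key π τ ρ s <lex key π τ ρ t)

Sorts : {n : ℕ} → (ℕ → PileType) → (Fin n → ℕ) → Permutation′ n → Set
Sorts τ ρ π = IsHetShuffle τ ρ π id

_≺[_]_ : {n : ℕ} → Fin n → PileType → Fin n → Set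
i ≺[ Q ] j = i Fin.< j
i ≺[ S ] j = j Fin.< i

≺-dec : {n : ℕ} (i : Fin n) (t : PileType) (j : Fin n) → Dec (i ≺[ t ] j)
≺-dec i Q j = i Fin.<? j
≺-dec i S j = j Fin.<? i

[_] : {P : Set} → Dec P → ℕ
[ yes _ ] = 1
[ no _ ] = 0

-- The condition: ρ(s+1) ≥ ρ(s) + [π(s+1) ≺_{τ(ρ(s))} π(s)] for all s ∈ [n-1]
-- (labels s, s+1 are fromℕ< of i and suc i, for i + 1 < n).
Condition : {n : ℕ} → (ℕ → PileType) → (Fin n → ℕ) → Permutation′ n → Set
Condition {n} τ ρ π =
  (i : ℕ) (h : suc i ℕ.< n) →
    let s  = fromℕ< (<-trans (n<1+n i) h)
        s' = fromℕ< h
    in ρ s' ≥ ρ s + [ ≺-dec (π ⟨$⟩ʳ s') (τ (ρ s)) (π ⟨$⟩ʳ s) ]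

-- (τ, ρ) sorts π iff the key s ↦ (ρ(s), ±π(s)) is strictly increasing, and as the
-- lexicographic order is transitive it is enough to compare consecutive labels s, s+1.
-- Their keys compare by pile first; on a common pile the sign turns the comparison into
-- ≺_{τ(ρ(s))}, and as π(s) ≠ π(s+1) the keys then increase iff not π(s+1) ≺ π(s).
-- Together the two cases say exactly ρ(s+1) ≥ ρ(s) + [π(s+1) ≺_{τ(ρ(s))} π(s)].
{-# OPTIONS --safe #-}
module Submission where

open import Defs
open import Level using (Level)
open import Data.Nat as ℕ using (ℕ; suc; _+_; _≤_)
import Data.Nat.Properties as ℕₚ
open import Data.Integer as ℤ using (ℤ; +_; -_; +<+)
import Data.Integer.Properties as ℤₚ
open import Data.Fin using (Fin; toℕ; fromℕ<; _<_)
open import Data.Fin.Properties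
  using (toℕ-fromℕ<; fromℕ<-toℕ; toℕ<n; toℕ-injective; <⇒≢; ≤∧≢⇒<; <-asym; <-cmp)
open import Data.Fin.Permutation using (Permutation′; _⟨$⟩ʳ_)
open import Data.Product using (_×_; _,_)
open import Data.Product.Relation.Binary.Lex.Strict using (×-Lex; ×-isStrictPartialOrder)
open import Data.Product.Relation.Binary.Pointwise.NonDependent using (Pointwise)
open import Data.Sum using (inj₁; inj₂)
open import Data.Empty using (⊥-elim)
open import Function using (_∘_; const)
open import Function.Bundles using (_⇔_; mk⇔; Equivalence; Injection)
open import Function.Properties.Inverse using (↔⇒↣)
open import Function.Construct.Symmetry using (⇔-sym)
open import Function.Related.Propositional using (module EquationalReasoning)
open import Relation.Binary.Core using (Rel; _Preserves_⟶_)
open import Relation.Binary.Definitions using (Transitive; Asymmetric; Irreflexive; tri<; tri≈; tri>)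
open import Relation.Binary.Structures using (IsStrictPartialOrder)
open import Relation.Binary.PropositionalEquality using (_≡_; _≢_; refl; sym; trans; subst; subst₂)
open import Relation.Nullary using (¬_; Dec; yes; no)

private
  variable
    a ℓ ℓ₁ ℓ₂ : Level
    n : ℕ

-- Consecutive pairs (s, s+1), indexed as in Condition so that Condition τ ρ π is an Adjacent.
Adjacent : Rel (Fin n) ℓ → Set ℓ
Adjacent {n} R = ∀ i (h : suc i ℕ.< n) → R (fromℕ< (ℕₚ.<-trans (ℕₚ.n<1+n i) h)) (fromℕ< h)

fromℕ<-adjacent : ∀ i (h : suc i ℕ.< n) → fromℕ< (ℕₚ.<-trans (ℕₚ.n<1+n i) h) < fromℕ< h
fromℕ<-adjacent i h = subst₂ ℕ._<_ (sym (toℕ-fromℕ< _)) (sym (toℕ-fromℕ< h)) (ℕₚ.n<1+n i)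

Adjacent-cong : {R R′ : Rel (Fin n) ℓ} →
  (∀ s t → s < t → R s t ⇔ R′ s t) → Adjacent R ⇔ Adjacent R′
Adjacent-cong R⇔R′ = mk⇔
  (λ adj i h → Equivalence.to   (R⇔R′ _ _ (fromℕ<-adjacent i h)) (adj i h))
  (λ adj i h → Equivalence.from (R⇔R′ _ _ (fromℕ<-adjacent i h)) (adj i h))

module _ {R : Rel (Fin n) ℓ} (R-trans : Transitive R) (adj : Adjacent R) where

  private
    below : ∀ j (h : j ℕ.< n) s → toℕ s ℕ.< j → R s (fromℕ< h)
    below (suc i) h s (ℕ.s≤s s≤i) with ℕₚ.m≤n⇒m<n∨m≡n s≤i
    ... | inj₁ s<i = R-trans (below i (ℕₚ.<-trans (ℕₚ.n<1+n i) h) s s<i) (adj i h)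
    ... | inj₂ s≡i =
      subst (λ x → R x (fromℕ< h)) (toℕ-injective (trans (toℕ-fromℕ< _) (sym s≡i))) (adj i h)

  adjacent⇒preserves : ∀ {s t} → s < t → R s t
  adjacent⇒preserves {s} {t} s<t =
    subst (R s) (fromℕ<-toℕ t (toℕ<n t)) (below (toℕ t) (toℕ<n t) s s<t)

preserves⇔adjacent : {R : Rel (Fin n) ℓ} → Transitive R → (∀ {s t} → s < t → R s t) ⇔ Adjacent R
preserves⇔adjacent R-trans = mk⇔
  (λ mono i h → mono (fromℕ<-adjacent i h))
  (adjacent⇒preserves R-trans)

embedding⇔preserves : {A : Set a} {_≺_ : Rel A ℓ} (f : Fin n → A) → Asymmetric _≺_ →
  (∀ s t → s < t ⇔ f s ≺ f t) ⇔ f Preserves _<_ ⟶ _≺_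
embedding⇔preserves {_≺_ = _≺_} f ≺-asym = mk⇔ preserves embedding
  where
  preserves : (∀ s t → s < t ⇔ f s ≺ f t) → f Preserves _<_ ⟶ _≺_
  preserves emb {s} {t} = Equivalence.to (emb s t)

  reflects : f Preserves _<_ ⟶ _≺_ → ∀ {s t} → f s ≺ f t → s < t
  reflects mono {s} {t} fs≺ft with <-cmp s t
  ... | tri< s<t _ _ = s<t
  ... | tri≈ _ refl _ = ⊥-elim (≺-asym fs≺ft fs≺ft)
  ... | tri> _ _ t<s = ⊥-elim (≺-asym fs≺ft (mono t<s))

  embedding : f Preserves _<_ ⟶ _≺_ → ∀ s t → s < t ⇔ f s ≺ f t
  embedding mono s t = mk⇔ mono (reflects mono)

×-Lex-fst≡⇔ : {A B : Set a} {_<₁_ : Rel A ℓ₁} {_<₂_ : Rel B ℓ₂} → Irreflexive _≡_ _<₁_ →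
  ∀ {x a b} → ×-Lex _≡_ _<₁_ _<₂_ (x , a) (x , b) ⇔ a <₂ b
×-Lex-fst≡⇔ {_<₁_ = _<₁_} {_<₂_} <₁-irrefl = mk⇔ second (λ a<b → inj₂ (refl , a<b))
  where
  second : ∀ {x a b} → ×-Lex _≡_ _<₁_ _<₂_ (x , a) (x , b) → a <₂ b
  second (inj₁ x<x) = ⊥-elim (<₁-irrefl refl x<x)
  second (inj₂ (_ , a<b)) = a<b

<lex-isStrictPartialOrder : IsStrictPartialOrder (Pointwise _≡_ _≡_) _<lex_
<lex-isStrictPartialOrder =
  ×-isStrictPartialOrder ℕₚ.<-isStrictPartialOrder ℤₚ.<-isStrictPartialOrder

open IsStrictPartialOrder <lex-isStrictPartialOrder
  using () renaming (trans to <lex-trans; asym to <lex-asym)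

<lex⇒≤ : ∀ {r r′ : ℕ} {a b : ℤ} → (r , a) <lex (r′ , b) → r ≤ r′
<lex⇒≤ (inj₁ r<r′) = ℕₚ.<⇒≤ r<r′
<lex⇒≤ (inj₂ (refl , _)) = ℕₚ.≤-refl

<⇔≯ : {x y : Fin n} → x ≢ y → x < y ⇔ (¬ y < x)
<⇔≯ x≢y = mk⇔ <-asym (λ y≮x → ≤∧≢⇒< (ℕₚ.≮⇒≥ y≮x) x≢y)

≺⇔⊀ : ∀ t {x y : Fin n} → x ≢ y → x ≺[ t ] y ⇔ (¬ y ≺[ t ] x)
≺⇔⊀ Q x≢y = <⇔≯ x≢y
≺⇔⊀ S x≢y = <⇔≯ (x≢y ∘ sym)

m+[d]≤1+m : {P : Set} (d : Dec P) (m : ℕ) → m + [ d ] ≤ suc m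
m+[d]≤1+m (yes _) m = ℕₚ.≤-reflexive (ℕₚ.+-comm m 1)
m+[d]≤1+m (no _)  m = ℕₚ.m≤n⇒m≤1+n (ℕₚ.≤-reflexive (ℕₚ.+-identityʳ m))

m+[d]≤m⇔¬P : {P : Set} (d : Dec P) (m : ℕ) → m + [ d ] ≤ m ⇔ (¬ P)
m+[d]≤m⇔¬P (yes p) m = mk⇔ (⊥-elim ∘ ℕₚ.m+1+n≰m m) (λ ¬p → ⊥-elim (¬p p))
m+[d]≤m⇔¬P (no ¬p) m = mk⇔ (const ¬p) (const (ℕₚ.≤-reflexive (ℕₚ.+-identityʳ m)))

signed : PileType → Fin n → ℤ
signed Q x = + toℕ x
signed S x = - + toℕ x

signed-<⇔≺ : ∀ t {x y : Fin n} → signed t x ℤ.< signed t y ⇔ x ≺[ t ] y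
signed-<⇔≺ Q = mk⇔ ℤₚ.drop‿+<+ +<+
signed-<⇔≺ S = mk⇔ (ℤₚ.drop‿+<+ ∘ ℤₚ.neg-cancel-<) (ℤₚ.neg-mono-< ∘ +<+)

signedKey : (ℕ → PileType) → ℕ → Fin n → ℕ × ℤ
signedKey τ r x = r , signed (τ r) x

key≡signedKey : (π : Permutation′ n) (τ : ℕ → PileType) (ρ : Fin n → ℕ) (s : Fin n) →
  key π τ ρ s ≡ signedKey τ (ρ s) (π ⟨$⟩ʳ s)
key≡signedKey π τ ρ s with τ (ρ s)
... | Q = refl
... | S = refl

signedKey-<lex⇔ : (τ : ℕ → PileType) {r r′ : ℕ} {x y : Fin n} → x ≢ y →
  signedKey τ r x <lex signedKey τ r′ y ⇔ r + [ ≺-dec y (τ r) x ] ≤ r′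
signedKey-<lex⇔ τ {r} {r′} {x} {y} x≢y with ℕₚ.<-cmp r r′
... | tri< r<r′ _ _ = mk⇔
  (const (ℕₚ.≤-trans (m+[d]≤1+m (≺-dec y (τ r) x) r) r<r′))
  (const (inj₁ r<r′))
... | tri> _ _ r′<r = mk⇔
  (⊥-elim ∘ ℕₚ.<⇒≱ r′<r ∘ <lex⇒≤)
  (⊥-elim ∘ ℕₚ.<⇒≱ r′<r ∘ ℕₚ.≤-trans (ℕₚ.m≤m+n r _))
... | tri≈ _ refl _ = begin
  signedKey τ r x <lex signedKey τ r y  ∼⟨ ×-Lex-fst≡⇔ {_<₂_ = ℤ._<_} ℕₚ.<-irrefl ⟩
  signed (τ r) x ℤ.< signed (τ r) y     ∼⟨ signed-<⇔≺ (τ r) ⟩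
  x ≺[ τ r ] y                          ∼⟨ ≺⇔⊀ (τ r) x≢y ⟩
  (¬ y ≺[ τ r ] x)                      ∼⟨ ⇔-sym (m+[d]≤m⇔¬P (≺-dec y (τ r) x) r) ⟩
  r + [ ≺-dec y (τ r) x ] ≤ r           ∎
  where open EquationalReasoning

key-<lex⇔condition : (π : Permutation′ n) (τ : ℕ → PileType) (ρ : Fin n → ℕ) (s t : Fin n) →
  s ≢ t →
  key π τ ρ s <lex key π τ ρ t ⇔ ρ s + [ ≺-dec (π ⟨$⟩ʳ t) (τ (ρ s)) (π ⟨$⟩ʳ s) ] ≤ ρ t
key-<lex⇔condition π τ ρ s t s≢t rewrite key≡signedKey π τ ρ s | key≡signedKey π τ ρ t =
  signedKey-<lex⇔ τ (s≢t ∘ Injection.injective (↔⇒↣ π))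

lemma7 : (n : ℕ) (π : Permutation′ n) (τ : ℕ → PileType) (ρ : Fin n → ℕ) →
    Sorts τ ρ π ⇔ Condition τ ρ π
lemma7 n π τ ρ = begin
  Sorts τ ρ π                      ∼⟨ embedding⇔preserves {_≺_ = _<lex_} (key π τ ρ) <lex-asym ⟩
  key π τ ρ Preserves _<_ ⟶ _<lex_ ∼⟨ preserves⇔adjacent <lex-trans ⟩
  Adjacent (λ s t → key π τ ρ s <lex key π τ ρ t)
                                   ∼⟨ Adjacent-cong (λ s t → key-<lex⇔condition π τ ρ s t ∘ <⇒≢) ⟩
  Condition τ ρ π                  ∎
  where open EquationalReasoning
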